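{- Let $a, b$ be nonzero integers with $|a| \neq 1$. Then there exist constants $c>0$ and $x_0$, depending on $a$ and $b$, such that for all $x \geq x_0$, $$\#\{p \leq x \text{ prime} : p \nmid ab \text{ and } b \bmod p \in \langle a \bmod p \rangle \subset \mathbb{F}_p^*\} \geq c \log x .$$
   Context: Here $\langle a \bmod p\rangle$ denotes the cyclic subgroup of the multiplicative group $\mathbb{F}_p^*$ generated by the residue of $a$ modulo $p$; the condition $b \bmod p \in \langle a \bmod p\rangle$ means $b \equiv a^n \pmod p$ for some integer $n \geq 0$. -}

module Defs where

open import Data.Nat using (ℕ; _≤_)
open import Data.Nat.Primality using (Prime)
open import Data.Integer using (ℤ; +_; _*_; _-_; _^_)
open import Data.Integer.Divisibility using (_∣_)
open import Data.Product using (_×_; ∃-syntax)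
open import Relation.Nullary using (¬_)

-- b mod p lies in the cyclic subgroup ⟨a mod p⟩ of 𝔽_p^*:
-- b ≡ a^m (mod p) for some m ≥ 0.
InSubgroup : ℤ → ℤ → ℕ → Set
InSubgroup a b p = ∃[ m ] ((+ p) ∣ (b - a ^ m))

Good : ℤ → ℤ → ℕ → ℕ → Set
Good a b x p = Prime p × p ≤ x × ¬ ((+ p) ∣ (a * b)) × InSubgroup a b p

-- For nonzero integers a, b with ∣a∣ ≠ 1 there are ≥ c·log x primes p ≤ x,
-- p ∤ ab, with b ≡ a^m (mod p) for some m — stated as x ≤ 2^((k+1)·#primes).
--
-- Let A = (∣a∣²)^∣b∣ and N m = ∣b − A^m∣ = ∣b − a^(2∣b∣m)∣.  A prime factor p
-- of some N m with p ∤ b is good (p ∣ a would give p ∣ A^m, hence p ∣ b), and a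
-- common divisor of N i and N (i + d) divides D d = ∣b·(A^d − 1)∣.  Take a
-- block of k consecutive terms N (T + i), i < k, T = 3k + 3, with product F.
-- For a prime q let the peak be the term in which q occurs most often; the
-- q-part of every other term divides the peak term and hence D at their
-- distance.  So F ∣ Π·E², where Π is the product of the peak prime powers over
-- the s primes dividing F and E = ∏_{1 ≤ d ≤ k} D d.  Comparing sizes
-- (A^((3k+2)k) ≤ F, Π ≤ A^((4k+3)s), E ≤ A^((k+1)k)) yields k ≤ 7s, so the block
-- has at least k/7 − (∣b∣ + 1) good primes, all below A^(4k+3).  For given x
-- one uses the block with A^(4k+3) ≤ x < A^(4k+7).

module Submission where

open import Data.Nat
open import Data.Nat.Properties
open import Data.Nat.Divisibility
open import Data.Nat.Primality
open import Data.Nat.Primality.Factorisation using (factorise)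
open import Data.Nat.ListAction using (product)
open import Data.Nat.ListAction.Properties using (∈⇒∣product)
open import Data.Nat.Tactic.RingSolver using (solve-∀)
open import Data.Integer using (ℤ; ∣_∣; 0ℤ)
import Data.Integer as ℤ
import Data.Integer.Properties as ℤP
import Data.Integer.Divisibility.Signed as ℤDiv
import Data.Integer.Tactic.RingSolver as ℤSolver
open import Data.List using (List; []; _∷_; length; map; filter; downFrom)
open import Data.List.Properties using (length-filter; length-downFrom; filter-accept)
open import Data.List.Membership.Propositional using (_∈_)
open import Data.List.Membership.Propositional.Properties using (∈-filter⁺; ∈-downFrom⁺; ∈-map⁺)
open import Data.List.Relation.Unary.All using (All; []; _∷_)
import Data.List.Relation.Unary.All as All
import Data.List.Relation.Unary.All.Properties as All
open import Data.List.Relation.Unary.Unique.Propositional using (Unique)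
import Data.List.Relation.Unary.Unique.Propositional.Properties as Unique
open import Data.Product using (_×_; _,_; ∃-syntax)
open import Data.Sum using (_⊎_; inj₁; inj₂; [_,_]′)
open import Data.Empty using (⊥-elim)
open import Relation.Nullary using (¬_; yes; no)
open import Relation.Nullary.Decidable using (_×-dec_; ¬?)
open import Relation.Unary using (Decidable)
open import Relation.Binary.PropositionalEquality
open import Defs

prime≥2 : ∀ {p} → Prime p → 2 ≤ p
prime≥2 {p} pr = nonTrivial⇒n>1 p {{prime⇒nonTrivial pr}}

prime>0 : ∀ {p} → Prime p → 0 < p
prime>0 pr = <-trans z<s (prime≥2 pr)

n<m^n : ∀ m n → 1 < m → n < m ^ n
n<m^n m zero    1<m = z<s
n<m^n m (suc n) 1<m = ≤-<-trans (n<m^n m n 1<m) (^-monoʳ-< m 1<m (n<1+n n))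

^-cancelʳ-≤ : ∀ m {u v} → 1 < m → m ^ u ≤ m ^ v → u ≤ v
^-cancelʳ-≤ m {u} {v} 1<m mᵘ≤mᵛ with u ≤? v
... | yes u≤v = u≤v
... | no  u≰v = ⊥-elim (<⇒≱ (^-monoʳ-< m 1<m (≰⇒> u≰v)) mᵘ≤mᵛ)

^-mono-∣ : ∀ p {m n} → m ≤ n → p ^ m ∣ p ^ n
^-mono-∣ p {m} {n} m≤n = divides (p ^ (n ∸ m))
  (trans (cong (p ^_) (sym (m∸n+n≡m m≤n))) (^-distribˡ-+-* p (n ∸ m) m))

bracket : ∀ (f : ℕ → ℕ) → (∀ k → f k < f (suc k)) →
          ∀ x → f 0 ≤ x → ∃[ k ] (f k ≤ x × x < f (suc k))
bracket f f-< zero    f0≤0 = 0 , f0≤0 , ≤-<-trans z≤n (f-< 0)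
bracket f f-< (suc x) f0≤1+x with f 0 ≤? x
... | no  f0≰x = 0 , f0≤1+x , subst (_< f 1) (≤-antisym f0≤1+x (≰⇒> f0≰x)) (f-< 0)
... | yes f0≤x with bracket f f-< x f0≤x
...   | k , fk≤x , x<fk+1 with m≤n⇒m<n∨m≡n x<fk+1
...     | inj₁ 1+x<fk+1 = k , m≤n⇒m≤1+n fk≤x , 1+x<fk+1
...     | inj₂ 1+x≡fk+1 = suc k , ≤-reflexive (sym 1+x≡fk+1) , subst (_< f (suc (suc k))) (sym 1+x≡fk+1) (f-< (suc k))

-- p-adic valuations.

record IsValuation (p n e : ℕ) : Set where
  field
    pow∣ : p ^ e ∣ n
    pow∤ : ¬ (p ^ suc e ∣ n)
open IsValuation

-- The p-adic valuation, computed by dividing by p as long as possible;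
-- the fuel bounds the number of divisions, and n units of fuel suffice.
valuationFuel : ℕ → ℕ → ℕ → ℕ
valuationFuel zero    p n = 0
valuationFuel (suc f) p n with p ∣? n
... | yes p∣n = suc (valuationFuel f p (quotient p∣n))
... | no  _   = 0

val : ℕ → ℕ → ℕ
val p n = valuationFuel n p n

valuationFuel-correct : ∀ f {p n} → Prime p → 0 < n → n ≤ f →
                        IsValuation p n (valuationFuel f p n)
valuationFuel-correct zero    pr n>0 n≤0 = ⊥-elim (<⇒≱ n>0 n≤0)
valuationFuel-correct (suc f) {p} {n} pr n>0 n≤f with p ∣? n
... | no p∤n = record
  { pow∣ = divides n (sym (*-identityʳ n))
  ; pow∤ = λ p¹∣n → p∤n (subst (_∣ n) (*-identityʳ p) p¹∣n) }
... | yes p∣n@(divides q n≡qp) = record { pow∣ = pow∣′ ; pow∤ = pow∤′ }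
  where
  q<n : q < n
  q<n = quotient-< p∣n {{prime⇒nonTrivial pr}} {{>-nonZero n>0}}
  q>0 : 0 < q
  q>0 = >-nonZero⁻¹ q {{quotient≢0 p∣n {{>-nonZero n>0}}}}
  v : ℕ
  v = valuationFuel f p q
  ih : IsValuation p q v
  ih = valuationFuel-correct f pr q>0 (≤-pred (≤-trans q<n n≤f))
  n≡p*q : n ≡ p * q
  n≡p*q = trans n≡qp (*-comm q p)
  pow∣′ : p * p ^ v ∣ n
  pow∣′ = subst (p * p ^ v ∣_) (sym n≡p*q) (*-monoʳ-∣ p (pow∣ ih))
  pow∤′ : ¬ (p * (p * p ^ v) ∣ n)
  pow∤′ h = pow∤ ih (*-cancelˡ-∣ p {{prime⇒nonZero pr}} (subst (p * (p * p ^ v) ∣_) n≡p*q h))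

val-correct : ∀ {p n} → Prime p → 0 < n → IsValuation p n (val p n)
val-correct {n = n} pr n>0 = valuationFuel-correct n pr n>0 ≤-refl

val-maximal : ∀ {p n e} → Prime p → 0 < n → p ^ e ∣ n → e ≤ val p n
val-maximal {p} {n} {e} pr n>0 pᵉ∣n with e ≤? val p n
... | yes e≤v = e≤v
... | no  e≰v = ⊥-elim (pow∤ (val-correct pr n>0) (∣-trans (^-mono-∣ p (≰⇒> e≰v)) pᵉ∣n))

val-unique : ∀ {p n e} → Prime p → 0 < n → IsValuation p n e → e ≡ val p n
val-unique {p} {n} {e} pr n>0 isVal = ≤-antisym (val-maximal pr n>0 (pow∣ isVal)) v≤e
  where
  v≤e : val p n ≤ e
  v≤e with val p n ≤? e
  ... | yes v≤e = v≤e
  ... | no  v≰e = ⊥-elim (pow∤ isVal (∣-trans (^-mono-∣ p (≰⇒> v≰e)) (pow∣ (val-correct pr n>0))))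

val>0⇒∣ : ∀ {p n} → Prime p → 0 < n → 0 < val p n → p ∣ n
val>0⇒∣ {p} {n} pr n>0 v>0 =
  ∣-trans (subst (_∣ p ^ val p n) (*-identityʳ p) (^-mono-∣ p v>0)) (pow∣ (val-correct pr n>0))

∣⇒val>0 : ∀ {p n} → Prime p → 0 < n → p ∣ n → 0 < val p n
∣⇒val>0 {p} pr n>0 p∣n = val-maximal pr n>0 (subst (_∣ _) (sym (*-identityʳ p)) p∣n)

∤⇒val≡0 : ∀ {p n} → Prime p → 0 < n → ¬ (p ∣ n) → val p n ≡ 0
∤⇒val≡0 {p} {n} pr n>0 p∤n with val p n in v≡
... | zero  = refl
... | suc _ = ⊥-elim (p∤n (val>0⇒∣ pr n>0 (subst (0 <_) (sym v≡) z<s)))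

valuation-cofactor : ∀ {p n e} → IsValuation p n e → ∃[ n′ ] (n ≡ n′ * p ^ e × ¬ (p ∣ n′))
valuation-cofactor {p} {n} {e} isVal with pow∣ isVal
... | divides n′ n≡n′pᵉ = n′ , n≡n′pᵉ , p∤n′
  where
  p∤n′ : ¬ (p ∣ n′)
  p∤n′ (divides r n′≡rp) = pow∤ isVal (divides r
    (trans n≡n′pᵉ (trans (cong (_* p ^ e) n′≡rp) (*-assoc r p (p ^ e)))))

-- The exponent u + w is exact: after cancelling
-- p^(u+w), a further factor p would divide the product of the cofactors of
-- m and n, which are prime to p (Euclid's lemma).
val-* : ∀ {p m n} → Prime p → 0 < m → 0 < n → val p (m * n) ≡ val p m + val p n
val-* {p} {m} {n} pr m>0 n>0 = sym (val-unique pr (*-mono-≤ m>0 n>0) isVal)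
  where
  u w : ℕ
  u = val p m
  w = val p n
  isVal : IsValuation p (m * n) (u + w)
  pow∣ isVal = subst (_∣ m * n) (sym (^-distribˡ-+-* p u w))
    (*-pres-∣ (pow∣ (val-correct pr m>0)) (pow∣ (val-correct pr n>0)))
  pow∤ isVal pᵘ⁺ʷ⁺¹∣mn
    with valuation-cofactor (val-correct pr m>0) | valuation-cofactor (val-correct pr n>0)
  ... | m′ , m≡ , p∤m′ | n′ , n≡ , p∤n′ = [ p∤m′ , p∤n′ ]′ (euclidsLemma m′ n′ pr p∣m′n′)
    where
    mn≡ : m * n ≡ p ^ (u + w) * (m′ * n′)
    mn≡ = begin
      m * n                         ≡⟨ cong₂ _*_ m≡ n≡ ⟩
      (m′ * p ^ u) * (n′ * p ^ w)   ≡⟨ regroup m′ (p ^ u) n′ (p ^ w) ⟩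
      (p ^ u * p ^ w) * (m′ * n′)   ≡⟨ cong (_* (m′ * n′)) (sym (^-distribˡ-+-* p u w)) ⟩
      p ^ (u + w) * (m′ * n′)       ∎
      where
      open ≡-Reasoning
      regroup : ∀ x y z t → (x * y) * (z * t) ≡ (y * t) * (x * z)
      regroup = solve-∀
    p∣m′n′ : p ∣ m′ * n′
    p∣m′n′ = *-cancelˡ-∣ (p ^ (u + w)) {{m^n≢0 p (u + w) {{prime⇒nonZero pr}}}}
      (subst₂ _∣_ (*-comm p (p ^ (u + w))) mn≡ pᵘ⁺ʷ⁺¹∣mn)

primeDivisor : ∀ n → 2 ≤ n → ∃[ p ] (Prime p × p ∣ n)
primeDivisor n@(suc _) n≥2 with factorise n
... | record { factors = [] ; isFactorisation = eq } = ⊥-elim (<⇒≢ n≥2 (sym eq))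
... | record { factors = p ∷ ps ; isFactorisation = eq ; factorsPrime = pr ∷ _ } =
  p , pr , divides (product ps) (trans eq (*-comm p _))

-- Induction on m, splitting off a
-- prime factor p of m, which must then also divide n.
∣-byValuations : ∀ {m n} → 0 < m → 0 < n → (∀ p → Prime p → val p m ≤ val p n) → m ∣ n
∣-byValuations {m} = withFuel m ≤-refl
  where
  withFuel : ∀ f {m n} → m ≤ f → 0 < m → 0 < n → (∀ p → Prime p → val p m ≤ val p n) → m ∣ n
  withFuel f        {1}           _   _   _   _ = 1∣ _
  withFuel zero     {suc (suc _)} ()
  withFuel (suc f)  {m@(suc (suc _))} {n} m≤f m>0 n>0 val≤ with primeDivisor m (s≤s (s≤s z≤n))
  ... | p , pr , p∣m@(divides m′ m≡m′p) with val>0⇒∣ pr n>0 (≤-trans (∣⇒val>0 pr m>0 p∣m) (val≤ p pr))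
  ... | divides n′ n≡n′p = subst₂ _∣_ (sym m≡m′p) (sym n≡n′p) (*-monoˡ-∣ p (withFuel f m′≤f m′>0 n′>0 val≤′))
    where
    m′>0 : 0 < m′
    m′>0 = >-nonZero⁻¹ m′ {{quotient≢0 p∣m {{>-nonZero m>0}}}}
    n′>0 : 0 < n′
    n′>0 = >-nonZero⁻¹ n′ {{quotient≢0 (divides n′ n≡n′p) {{>-nonZero n>0}}}}
    m′≤f : m′ ≤ f
    m′≤f = ≤-pred (≤-trans (quotient-< p∣m {{prime⇒nonTrivial pr}} {{>-nonZero m>0}}) m≤f)
    val≤′ : ∀ q → Prime q → val q m′ ≤ val q n′
    val≤′ q qr = +-cancelʳ-≤ (val q p) (val q m′) (val q n′)
      (subst₂ _≤_ (trans (cong (val q) m≡m′p) (val-* qr m′>0 (prime>0 pr)))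
                  (trans (cong (val q) n≡n′p) (val-* qr n′>0 (prime>0 pr))) (val≤ q qr))

-- Finite sums and products over the range i < k, and where maxima occur.

sumBelow : (ℕ → ℕ) → ℕ → ℕ
sumBelow f zero    = 0
sumBelow f (suc k) = sumBelow f k + f k

prodBelow : (ℕ → ℕ) → ℕ → ℕ
prodBelow f zero    = 1
prodBelow f (suc k) = prodBelow f k * f k

sumBelow-cong : ∀ f g k → (∀ i → i < k → f i ≡ g i) → sumBelow f k ≡ sumBelow g k
sumBelow-cong f g zero    f≡g = refl
sumBelow-cong f g (suc k) f≡g =
  cong₂ _+_ (sumBelow-cong f g k (λ i i<k → f≡g i (m<n⇒m<1+n i<k))) (f≡g k ≤-refl)

sumBelow-mono : ∀ f g k → (∀ i → i < k → f i ≤ g i) → sumBelow f k ≤ sumBelow g k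
sumBelow-mono f g zero    f≤g = z≤n
sumBelow-mono f g (suc k) f≤g =
  +-mono-≤ (sumBelow-mono f g k (λ i i<k → f≤g i (m<n⇒m<1+n i<k))) (f≤g k ≤-refl)

sumBelow-monoʳ : ∀ f {m n} → m ≤ n → sumBelow f m ≤ sumBelow f n
sumBelow-monoʳ f {m} {zero}  z≤n = z≤n
sumBelow-monoʳ f {m} {suc n} m≤1+n with m≤n⇒m<n∨m≡n m≤1+n
... | inj₁ m<1+n = ≤-trans (sumBelow-monoʳ f (≤-pred m<1+n)) (m≤m+n (sumBelow f n) (f n))
... | inj₂ refl  = ≤-refl

sumBelow-split : ∀ f m n → sumBelow f (m + n) ≡ sumBelow f m + sumBelow (λ j → f (m + j)) n
sumBelow-split f m zero    = trans (cong (sumBelow f) (+-identityʳ m)) (sym (+-identityʳ _))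
sumBelow-split f m (suc n) = trans (cong (sumBelow f) (+-suc m n))
  (trans (cong (_+ f (m + n)) (sumBelow-split f m n)) (+-assoc (sumBelow f m) _ (f (m + n))))

sumBelow-reverse : ∀ f n → sumBelow f n ≡ sumBelow (λ i → f (n ∸ suc i)) n
sumBelow-reverse f zero    = refl
sumBelow-reverse f (suc n) = begin
  sumBelow f n + f n                           ≡⟨ +-comm (sumBelow f n) (f n) ⟩
  f n + sumBelow f n                           ≡⟨ cong (f n +_) (sumBelow-reverse f n) ⟩
  f n + sumBelow (λ i → f (n ∸ suc i)) n       ≡⟨ sym (sumBelow-split (λ i → f (n ∸ i)) 1 n) ⟩
  sumBelow (λ i → f (suc n ∸ suc i)) (suc n)   ∎
  where open ≡-Reasoning

sumBelow-aroundPeak : ∀ (v w : ℕ → ℕ) k c → c < k →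
  (∀ i → i < c → v i ≤ w (c ∸ i)) →
  (∀ d → c + suc d < k → v (c + suc d) ≤ w (suc d)) →
  sumBelow v k ≤ v c + (sumBelow (λ d → w (suc d)) k + sumBelow (λ d → w (suc d)) k)
sumBelow-aroundPeak v w k c c<k left right = begin
  sumBelow v k                                  ≡⟨ cong (sumBelow v) (sym k≡c+1+r) ⟩
  sumBelow v (c + suc r)                        ≡⟨ sumBelow-split v c (suc r) ⟩
  sumBelow v c + sumBelow (λ j → v (c + j)) (suc r)
    ≡⟨ cong (sumBelow v c +_) (sumBelow-split (λ j → v (c + j)) 1 r) ⟩
  sumBelow v c + (v (c + 0) + sumBelow (λ d → v (c + suc d)) r)
    ≡⟨ cong (λ z → sumBelow v c + (v z + sumBelow (λ d → v (c + suc d)) r)) (+-identityʳ c) ⟩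
  sumBelow v c + (v c + sumBelow (λ d → v (c + suc d)) r)
    ≤⟨ +-mono-≤ leftPart (+-monoʳ-≤ (v c) rightPart) ⟩
  W + (v c + W)                                 ≡⟨ +-comm-middle W (v c) ⟩
  v c + (W + W)                                 ∎
  where
  open ≤-Reasoning
  W r : ℕ
  W = sumBelow (λ d → w (suc d)) k
  r = k ∸ suc c
  k≡c+1+r : c + suc r ≡ k
  k≡c+1+r = trans (+-suc c r) (m+[n∸m]≡n c<k)
  +-comm-middle : ∀ x y → x + (y + x) ≡ y + (x + x)
  +-comm-middle = solve-∀
  leftPart : sumBelow v c ≤ W
  leftPart = begin
    sumBelow v c                          ≤⟨ sumBelow-mono v (λ i → w (c ∸ i)) c left ⟩
    sumBelow (λ i → w (c ∸ i)) c
      ≡⟨ sumBelow-cong _ _ c (λ i i<c → cong w (+-∸-assoc 1 i<c)) ⟩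
    sumBelow (λ i → w (suc (c ∸ suc i))) c ≡⟨ sym (sumBelow-reverse (λ d → w (suc d)) c) ⟩
    sumBelow (λ d → w (suc d)) c          ≤⟨ sumBelow-monoʳ _ (<⇒≤ c<k) ⟩
    W                                     ∎
  rightPart : sumBelow (λ d → v (c + suc d)) r ≤ W
  rightPart = begin
    sumBelow (λ d → v (c + suc d)) r
      ≤⟨ sumBelow-mono _ _ r (λ d d<r → right d (subst (c + suc d <_) k≡c+1+r (+-monoʳ-< c (s≤s d<r)))) ⟩
    sumBelow (λ d → w (suc d)) r          ≤⟨ sumBelow-monoʳ _ (m∸n≤m k (suc c)) ⟩
    W                                     ∎

prodBelow>0 : ∀ f k → (∀ i → i < k → 0 < f i) → 0 < prodBelow f k
prodBelow>0 f zero    f>0 = z<s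
prodBelow>0 f (suc k) f>0 = *-mono-≤ (prodBelow>0 f k (λ i i<k → f>0 i (m<n⇒m<1+n i<k))) (f>0 k ≤-refl)

prodBelow-lower : ∀ f k L → (∀ i → i < k → L ≤ f i) → L ^ k ≤ prodBelow f k
prodBelow-lower f zero    L L≤f = ≤-refl
prodBelow-lower f (suc k) L L≤f = ≤-trans (≤-reflexive (*-comm L (L ^ k)))
  (*-mono-≤ (prodBelow-lower f k L (λ i i<k → L≤f i (m<n⇒m<1+n i<k))) (L≤f k ≤-refl))

prodBelow-upper : ∀ f k U → (∀ i → i < k → f i ≤ U) → prodBelow f k ≤ U ^ k
prodBelow-upper f zero    U f≤U = ≤-refl
prodBelow-upper f (suc k) U f≤U = ≤-trans
  (*-mono-≤ (prodBelow-upper f k U (λ i i<k → f≤U i (m<n⇒m<1+n i<k))) (f≤U k ≤-refl))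
  (≤-reflexive (*-comm (U ^ k) U))

prime∣prodBelow : ∀ {p} f k → Prime p → p ∣ prodBelow f k → ∃[ i ] (i < k × p ∣ f i)
prime∣prodBelow f zero    pr p∣1 = ⊥-elim (<⇒≱ (prime≥2 pr) (∣⇒≤ p∣1))
prime∣prodBelow f (suc k) pr p∣Πf with euclidsLemma (prodBelow f k) (f k) pr p∣Πf
... | inj₂ p∣fk = k , ≤-refl , p∣fk
... | inj₁ p∣Πf′ with prime∣prodBelow f k pr p∣Πf′
...   | i , i<k , p∣fi = i , m<n⇒m<1+n i<k , p∣fi

val-prodBelow : ∀ {p} f k → Prime p → (∀ i → i < k → 0 < f i) →
                val p (prodBelow f k) ≡ sumBelow (λ i → val p (f i)) k
val-prodBelow {p} f zero    pr f>0 = sym (val-unique pr z<s isVal)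
  where
  isVal : IsValuation p 1 0
  isVal = record { pow∣ = ∣-refl ; pow∤ = λ p¹∣1 → <⇒≱ (prime≥2 pr) (∣⇒≤ (subst (_∣ 1) (*-identityʳ p) p¹∣1)) }
val-prodBelow {p} f (suc k) pr f>0 = trans
  (val-* pr (prodBelow>0 f k f>0′) (f>0 k ≤-refl))
  (cong (_+ val p (f k)) (val-prodBelow f k pr f>0′))
  where
  f>0′ : ∀ i → i < k → 0 < f i
  f>0′ i i<k = f>0 i (m<n⇒m<1+n i<k)

argmax : (ℕ → ℕ) → ℕ → ℕ
argmax f zero = 0
argmax f (suc n) with f (argmax f n) ≤? f (suc n)
... | yes _ = suc n
... | no  _ = argmax f n

argmax-≤ : ∀ f n → argmax f n ≤ n
argmax-≤ f zero = z≤n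
argmax-≤ f (suc n) with f (argmax f n) ≤? f (suc n)
... | yes _ = ≤-refl
... | no  _ = m≤n⇒m≤1+n (argmax-≤ f n)

argmax-maximal : ∀ (f : ℕ → ℕ) n i → i ≤ n → f i ≤ f (argmax f n)
argmax-maximal f zero    .zero z≤n = ≤-refl
argmax-maximal f (suc n) i i≤1+n with f (argmax f n) ≤? f (suc n) | m≤n⇒m<n∨m≡n i≤1+n
... | yes old≤new | inj₁ i<1+n = ≤-trans (argmax-maximal f n i (≤-pred i<1+n)) old≤new
... | yes _       | inj₂ refl  = ≤-refl
... | no  _       | inj₁ i<1+n = argmax-maximal f n i (≤-pred i<1+n)
... | no  old≰new | inj₂ refl  = <⇒≤ (≰⇒> old≰new)

length-filter-∷ : ∀ {A : Set} {P : A → Set} (P? : Decidable P) x xs →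
                  length (filter P? xs) ≤ length (filter P? (x ∷ xs))
length-filter-∷ P? x xs with P? x
... | yes _ = n≤1+n _
... | no  _ = ≤-refl

length-filter-cover : ∀ {A : Set} {P Q R : A → Set}
  (P? : Decidable P) (Q? : Decidable Q) (R? : Decidable R) →
  (∀ {x} → P x → Q x ⊎ R x) → ∀ xs →
  length (filter P? xs) ≤ length (filter Q? xs) + length (filter R? xs)
length-filter-cover P? Q? R? cover [] = z≤n
length-filter-cover P? Q? R? cover (x ∷ xs) with P? x
... | no _ = ≤-trans (length-filter-cover P? Q? R? cover xs)
                     (+-mono-≤ (length-filter-∷ Q? x xs) (length-filter-∷ R? x xs))
... | yes px with cover px
...   | inj₁ qx = begin
  suc (length (filter P? xs))                                  ≤⟨ s≤s (length-filter-cover P? Q? R? cover xs) ⟩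
  suc (length (filter Q? xs) + length (filter R? xs))          ≤⟨ s≤s (+-monoʳ-≤ _ (length-filter-∷ R? x xs)) ⟩
  suc (length (filter Q? xs)) + length (filter R? (x ∷ xs))    ≡⟨ cong (_+ _) (sym (cong length (filter-accept Q? qx))) ⟩
  length (filter Q? (x ∷ xs)) + length (filter R? (x ∷ xs))    ∎
  where open ≤-Reasoning
...   | inj₂ rx = begin
  suc (length (filter P? xs))                                  ≤⟨ s≤s (length-filter-cover P? Q? R? cover xs) ⟩
  suc (length (filter Q? xs) + length (filter R? xs))          ≤⟨ s≤s (+-monoˡ-≤ _ (length-filter-∷ Q? x xs)) ⟩
  suc (length (filter Q? (x ∷ xs)) + length (filter R? xs))    ≡⟨ sym (+-suc _ _) ⟩
  length (filter Q? (x ∷ xs)) + suc (length (filter R? xs))    ≡⟨ cong (_ +_) (sym (cong length (filter-accept R? rx))) ⟩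
  length (filter Q? (x ∷ xs)) + length (filter R? (x ∷ xs))    ∎
  where open ≤-Reasoning

length-filter-downFrom-bounded : ∀ {P : ℕ → Set} (P? : Decidable P) B →
  (∀ {x} → P x → x ≤ B) → ∀ n → length (filter P? (downFrom n)) ≤ suc B
length-filter-downFrom-bounded P? B bound zero = z≤n
length-filter-downFrom-bounded P? B bound (suc n) with P? n
... | yes pn = s≤s (≤-trans (length-filter P? (downFrom n)) (≤-trans (≤-reflexive (length-downFrom n)) (bound pn)))
... | no  _  = length-filter-downFrom-bounded P? B bound n

product-map>0 : ∀ (g : ℕ → ℕ) xs → All (λ x → 0 < g x) xs → 0 < product (map g xs)
product-map>0 g []       []           = z<s
product-map>0 g (x ∷ xs) (gx>0 ∷ g>0) = *-mono-≤ gx>0 (product-map>0 g xs g>0)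

product-map-upper : ∀ (g : ℕ → ℕ) X xs → All (λ x → g x ≤ X) xs →
                    product (map g xs) ≤ X ^ length xs
product-map-upper g X []       []           = ≤-refl
product-map-upper g X (x ∷ xs) (gx≤X ∷ g≤X) = *-mono-≤ gx≤X (product-map-upper g X xs g≤X)

pos-^ : ∀ x n → (ℤ.+ x) ℤ.^ n ≡ ℤ.+ (x ^ n)
pos-^ x zero    = refl
pos-^ x (suc n) = trans (cong (ℤ.+ x ℤ.*_) (pos-^ x n)) (sym (ℤP.pos-* x (x ^ n)))

-- Even powers of a are powers of the natural number ∣a∣²; this is what
-- lets the argument run over ℕ.
even-power : ∀ a B m → a ℤ.^ (2 * B * m) ≡ ℤ.+ (((∣ a ∣ * ∣ a ∣) ^ B) ^ m)
even-power a B m = begin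
  a ℤ.^ (2 * B * m)                        ≡⟨ sym (ℤP.^-*-assoc a (2 * B) m) ⟩
  (a ℤ.^ (2 * B)) ℤ.^ m                    ≡⟨ cong (ℤ._^ m) (sym (ℤP.^-*-assoc a 2 B)) ⟩
  ((a ℤ.^ 2) ℤ.^ B) ℤ.^ m                  ≡⟨ cong (λ z → (z ℤ.^ B) ℤ.^ m) (square a) ⟩
  ((ℤ.+ (∣ a ∣ * ∣ a ∣)) ℤ.^ B) ℤ.^ m         ≡⟨ cong (ℤ._^ m) (pos-^ _ B) ⟩
  (ℤ.+ ((∣ a ∣ * ∣ a ∣) ^ B)) ℤ.^ m           ≡⟨ pos-^ _ m ⟩
  ℤ.+ (((∣ a ∣ * ∣ a ∣) ^ B) ^ m)           ∎
  where
  open ≡-Reasoning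
  self-product : ∀ i → i ℤ.* i ≡ ℤ.+ (∣ i ∣ * ∣ i ∣)
  self-product (ℤ.+ n)    = sym (ℤP.pos-* n n)
  self-product ℤ.-[1+ n ] = refl
  square : ∀ i → i ℤ.^ 2 ≡ ℤ.+ (∣ i ∣ * ∣ i ∣)
  square i = trans (cong (i ℤ.*_) (ℤP.*-identityʳ i)) (self-product i)

-- A common divisor of b − X and b − X·Y divides b·(Y − 1),
-- since b·(Y − 1) = (b − X)·Y − (b − X·Y).
common-divisor : ∀ q b X Y → q ∣ ∣ b ℤ.- X ∣ → q ∣ ∣ b ℤ.- X ℤ.* Y ∣ →
                 q ∣ ∣ b ℤ.* (Y ℤ.- ℤ.1ℤ) ∣
common-divisor q b X Y q∣b-X q∣b-XY = ℤDiv.∣⇒∣ᵤ (subst (ℤDiv._∣_ (ℤ.+ q)) (sym (identity b X Y))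
  (ℤDiv.∣m∣n⇒∣m-n (ℤDiv.∣m⇒∣m*n Y (ℤDiv.∣ᵤ⇒∣ {ℤ.+ q} {b ℤ.- X} q∣b-X))
                   (ℤDiv.∣ᵤ⇒∣ {ℤ.+ q} {b ℤ.- X ℤ.* Y} q∣b-XY)))
  where
  identity : ∀ b X Y → b ℤ.* (Y ℤ.- ℤ.1ℤ) ≡ (b ℤ.- X) ℤ.* Y ℤ.- (b ℤ.- X ℤ.* Y)
  identity = ℤSolver.solve-∀

divisor-of-b : ∀ q b y → q ∣ ∣ b ℤ.- y ∣ → q ∣ ∣ y ∣ → q ∣ ∣ b ∣
divisor-of-b q b y q∣b-y q∣y = ℤDiv.∣⇒∣ᵤ (subst (ℤDiv._∣_ (ℤ.+ q)) (identity b y)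
  (ℤDiv.∣m∣n⇒∣m+n (ℤDiv.∣ᵤ⇒∣ {ℤ.+ q} {b ℤ.- y} q∣b-y) (ℤDiv.∣ᵤ⇒∣ {ℤ.+ q} {y} q∣y)))
  where
  identity : ∀ b y → (b ℤ.- y) ℤ.+ y ≡ b
  identity = ℤSolver.solve-∀

∣y∣≤∣b∣+∣b-y∣ : ∀ b y → ∣ y ∣ ≤ ∣ b ∣ + ∣ b ℤ.- y ∣
∣y∣≤∣b∣+∣b-y∣ b y = subst (λ z → ∣ z ∣ ≤ ∣ b ∣ + ∣ b ℤ.- y ∣) (identity b y) (ℤP.∣i-j∣≤∣i∣+∣j∣ b (b ℤ.- y))
  where
  identity : ∀ b y → b ℤ.- (b ℤ.- y) ≡ y
  identity = ℤSolver.solve-∀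

∣b*[y-1]∣ : ∀ b y → 0 < y → ∣ b ℤ.* (ℤ.+ y ℤ.- ℤ.1ℤ) ∣ ≡ ∣ b ∣ * (y ∸ 1)
∣b*[y-1]∣ b (suc y) _ = ℤP.∣i*j∣≡∣i∣*∣j∣ b (ℤ.+ y)

-- The arithmetic of the final count: a block of length K ≥ 14c containing
-- at least K/7 − c good primes has K ≤ 14g, so 4(K+1) + 3 ≤ 154g.
block-exponent-bound : ∀ k g c → 14 * c ≤ suc k → suc k ≤ 7 * (g + c) → 4 * suc (suc k) + 3 ≤ 154 * g
block-exponent-bound k g c 14c≤K K≤7[g+c] = begin
  4 * suc K + 3      ≡⟨ expand K ⟩
  4 * K + 7 * 1      ≤⟨ +-monoʳ-≤ (4 * K) (*-monoʳ-≤ 7 (s≤s z≤n)) ⟩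
  4 * K + 7 * K      ≡⟨ collect K ⟩
  11 * K             ≤⟨ *-monoʳ-≤ 11 K≤14g ⟩
  11 * (14 * g)      ≡⟨ *-assoc 11 14 g ⟨
  154 * g            ∎
  where
  open ≤-Reasoning
  K : ℕ
  K = suc k
  expand : ∀ K → 4 * suc K + 3 ≡ 4 * K + 7 * 1
  expand = solve-∀
  collect : ∀ K → 4 * K + 7 * K ≡ 11 * K
  collect = solve-∀
  distribute : ∀ g c → 2 * (7 * (g + c)) ≡ 14 * g + 14 * c
  distribute = solve-∀
  K≤14g : K ≤ 14 * g
  K≤14g = +-cancelʳ-≤ K K (14 * g) (begin
    K + K              ≡⟨ cong (K +_) (+-identityʳ K) ⟨
    2 * K              ≤⟨ *-monoʳ-≤ 2 K≤7[g+c] ⟩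
    2 * (7 * (g + c))  ≡⟨ distribute g c ⟩
    14 * g + 14 * c    ≤⟨ +-monoʳ-≤ (14 * g) 14c≤K ⟩
    14 * g + K         ∎)

-- The sequence N m = ∣b − A^m∣ = ∣b − a^(2∣b∣m)∣ for A = (∣a∣²)^∣b∣, and the
-- numbers D d = ∣b·(A^d − 1)∣ bounding the common divisors of its terms.
module Sequence (a b : ℤ) (a≢0 : a ≢ 0ℤ) (b≢0 : b ≢ 0ℤ) (∣a∣≢1 : ∣ a ∣ ≢ 1) where

  B : ℕ
  B = ∣ b ∣

  A : ℕ
  A = (∣ a ∣ * ∣ a ∣) ^ B

  N : ℕ → ℕ
  N m = ∣ b ℤ.- ℤ.+ (A ^ m) ∣

  D : ℕ → ℕ
  D d = ∣ b ℤ.* (ℤ.+ (A ^ d) ℤ.- ℤ.1ℤ) ∣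

  ∣a∣>1 : 1 < ∣ a ∣
  ∣a∣>1 with ∣ a ∣ in ∣a∣≡
  ... | 0           = ⊥-elim (a≢0 (ℤP.∣i∣≡0⇒i≡0 ∣a∣≡))
  ... | 1           = ⊥-elim (∣a∣≢1 refl)
  ... | suc (suc _) = s≤s (s≤s z≤n)

  B>0 : 0 < B
  B>0 with ∣ b ∣ in ∣b∣≡
  ... | 0     = ⊥-elim (b≢0 (ℤP.∣i∣≡0⇒i≡0 ∣b∣≡))
  ... | suc _ = z<s

  B<A : B < A
  B<A = <-≤-trans (n<m^n ∣ a ∣ B ∣a∣>1)
    (^-monoˡ-≤ B (m≤m*n ∣ a ∣ ∣ a ∣ {{>-nonZero (<-trans z<s ∣a∣>1)}}))

  A>1 : 1 < A
  A>1 = ≤-<-trans B>0 B<A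

  instance
    A≢0 : NonZero A
    A≢0 = >-nonZero (<-trans z<s A>1)

  A^>0 : ∀ m → 0 < A ^ m
  A^>0 m = m^n>0 A m

  N≡∣b-aⁿ∣ : ∀ m → N m ≡ ∣ b ℤ.- a ℤ.^ (2 * B * m) ∣
  N≡∣b-aⁿ∣ m = cong (λ z → ∣ b ℤ.- z ∣) (sym (even-power a B m))

  B+y≤A*y : ∀ y → 0 < y → B + y ≤ A * y
  B+y≤A*y y y>0 = begin
    B + y       ≤⟨ +-monoˡ-≤ y (≤-trans (≤-reflexive (sym (*-identityʳ B))) (*-monoʳ-≤ B y>0)) ⟩
    B * y + y   ≡⟨ +-comm (B * y) y ⟩
    suc B * y   ≤⟨ *-monoˡ-≤ y B<A ⟩
    A * y       ∎
    where open ≤-Reasoning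

  N-lower : ∀ m → A ^ m ≤ N (suc m)
  N-lower m = +-cancelˡ-≤ B (A ^ m) (N (suc m))
    (≤-trans (B+y≤A*y (A ^ m) (A^>0 m)) (∣y∣≤∣b∣+∣b-y∣ b (ℤ.+ (A ^ suc m))))

  N-upper : ∀ m → N m ≤ A ^ suc m
  N-upper m = ≤-trans (ℤP.∣i-j∣≤∣i∣+∣j∣ b (ℤ.+ (A ^ m))) (B+y≤A*y (A ^ m) (A^>0 m))

  N>0 : ∀ m → 0 < N (suc m)
  N>0 m = ≤-trans (A^>0 m) (N-lower m)

  D≡ : ∀ d → D d ≡ B * (A ^ d ∸ 1)
  D≡ d = ∣b*[y-1]∣ b (A ^ d) (A^>0 d)

  D-upper : ∀ d → D d ≤ A ^ suc d
  D-upper d = begin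
    D d               ≡⟨ D≡ d ⟩
    B * (A ^ d ∸ 1)   ≤⟨ *-monoʳ-≤ B (m∸n≤m (A ^ d) 1) ⟩
    B * A ^ d         ≤⟨ *-monoˡ-≤ (A ^ d) (<⇒≤ B<A) ⟩
    A * A ^ d         ∎
    where open ≤-Reasoning

  D>0 : ∀ d → 0 < D (suc d)
  D>0 d = subst (0 <_) (sym (D≡ (suc d)))
    (*-mono-≤ B>0 (∸-monoˡ-≤ 1 (*-mono-≤ A>1 (A^>0 d))))

  -- A common divisor of N i and N (i + d) divides D d, because
  -- A^(i+d) = A^i · A^d (see common-divisor).
  N-common-divisor : ∀ q i d → q ∣ N i → q ∣ N (i + d) → q ∣ D d
  N-common-divisor q i d q∣Nᵢ q∣Nᵢ₊d = common-divisor q b (ℤ.+ (A ^ i)) (ℤ.+ (A ^ d)) q∣Nᵢ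
    (subst (λ z → q ∣ ∣ b ℤ.- z ∣) A^[i+d]≡A^i*A^d q∣Nᵢ₊d)
    where
    A^[i+d]≡A^i*A^d : ℤ.+ (A ^ (i + d)) ≡ ℤ.+ (A ^ i) ℤ.* ℤ.+ (A ^ d)
    A^[i+d]≡A^i*A^d = trans (cong ℤ.+_ (^-distribˡ-+-* A i d)) (ℤP.pos-* (A ^ i) (A ^ d))

  N-divisor-of-a : ∀ q m → q ∣ ∣ a ∣ → q ∣ N (suc m) → q ∣ B
  N-divisor-of-a q m q∣a q∣N = divisor-of-b q b (ℤ.+ (A ^ suc m)) q∣N q∣A^[m+1]
    where
    ∣a∣∣A : ∣ a ∣ ∣ A
    ∣a∣∣A = subst (λ e → ∣ a ∣ ∣ (∣ a ∣ * ∣ a ∣) ^ e) (suc-pred B {{>-nonZero B>0}})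
      (∣m⇒∣m*n ((∣ a ∣ * ∣ a ∣) ^ pred B) (m∣m*n ∣ a ∣))
    q∣A^[m+1] : q ∣ A ^ suc m
    q∣A^[m+1] = ∣-trans q∣a (∣m⇒∣m*n (A ^ m) ∣a∣∣A)

  -- Upper bound for the terms of the k-th block (k = k′ + 1), see Block.
  blockBound : ℕ → ℕ
  blockBound k′ = A ^ (4 * suc k′ + 3)

  module Block (k′ : ℕ) where

    k : ℕ
    k = suc k′

    T : ℕ
    T = suc (3 * k + 2)

    term : ℕ → ℕ
    term i = N (T + i)

    term>0 : ∀ i → 0 < term i
    term>0 i = N>0 (3 * k + 2 + i)

    term-lower : ∀ i → A ^ (3 * k + 2) ≤ term i
    term-lower i = ≤-trans (^-monoʳ-≤ A (m≤m+n (3 * k + 2) i)) (N-lower (3 * k + 2 + i))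

    term-upper : ∀ i → i < k → term i ≤ blockBound k′
    term-upper i i<k = ≤-trans (N-upper (T + i)) (^-monoʳ-≤ A T+i+1≤4k+3)
      where
      T+i+1≤4k+3 : suc (T + i) ≤ 4 * k + 3
      T+i+1≤4k+3 = ≤-trans (s≤s (+-monoʳ-≤ T (≤-pred i<k))) (≤-reflexive (index-identity k′))
        where
        index-identity : ∀ k′ → suc (suc (3 * suc k′ + 2) + k′) ≡ 4 * suc k′ + 3
        index-identity = solve-∀

    F : ℕ
    F = prodBelow term k

    E : ℕ
    E = prodBelow (λ d → D (suc d)) k

    F>0 : 0 < F
    F>0 = prodBelow>0 term k (λ i _ → term>0 i)

    E>0 : 0 < E
    E>0 = prodBelow>0 (λ d → D (suc d)) k (λ d _ → D>0 d)

    peak : ℕ → ℕ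
    peak q = argmax (λ i → val q (term i)) k′

    -- For a single prime q, the exponents of q in the terms other than the
    -- peak are controlled by E: each such prime power also divides the peak
    -- term, hence divides D at the distance between the two positions.
    module PeakBound (q : ℕ) (q-prime : Prime q) where

      v : ℕ → ℕ
      v i = val q (term i)

      c : ℕ
      c = peak q

      c<k : c < k
      c<k = s≤s (argmax-≤ v k′)

      qᵛ∣term : ∀ i → q ^ v i ∣ term i
      qᵛ∣term i = IsValuation.pow∣ (val-correct q-prime (term>0 i))

      qᵛ∣peak : ∀ i → i < k → q ^ v i ∣ term c
      qᵛ∣peak i i<k = ∣-trans (^-mono-∣ q (argmax-maximal v k′ i (≤-pred i<k))) (qᵛ∣term c)

      shared-power : ∀ i d e → q ^ e ∣ term i → q ^ e ∣ term (i + suc d) → e ≤ val q (D (suc d))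
      shared-power i d e qᵉ∣termᵢ qᵉ∣termᵢ₊ₔ = val-maximal q-prime (D>0 d)
        (N-common-divisor (q ^ e) (T + i) (suc d) qᵉ∣termᵢ
          (subst (λ j → q ^ e ∣ N j) (sym (+-assoc T i (suc d))) qᵉ∣termᵢ₊ₔ))

      left-of-peak : ∀ i → i < c → v i ≤ val q (D (c ∸ i))
      left-of-peak i i<c = subst (λ d → v i ≤ val q (D d)) (sym (+-∸-assoc 1 i<c))
        (shared-power i (c ∸ suc i) (v i) (qᵛ∣term i)
          (subst (λ j → q ^ v i ∣ term j) (sym i+[c-i]≡c) (qᵛ∣peak i (<-trans i<c c<k))))
        where
        i+[c-i]≡c : i + suc (c ∸ suc i) ≡ c
        i+[c-i]≡c = trans (+-suc i (c ∸ suc i)) (m+[n∸m]≡n i<c)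

      right-of-peak : ∀ d → c + suc d < k → v (c + suc d) ≤ val q (D (suc d))
      right-of-peak d c+1+d<k =
        shared-power c d (v (c + suc d)) (qᵛ∣peak (c + suc d) c+1+d<k) (qᵛ∣term (c + suc d))

      val-F-bound : val q F ≤ v c + (val q E + val q E)
      val-F-bound = begin
        val q F                  ≡⟨ val-prodBelow term k q-prime (λ i _ → term>0 i) ⟩
        sumBelow v k             ≤⟨ sumBelow-aroundPeak v (λ d → val q (D d)) k c c<k left-of-peak right-of-peak ⟩
        v c + (W + W)            ≡⟨ cong (λ z → v c + (z + z)) (sym (val-prodBelow (λ d → D (suc d)) k q-prime (λ d _ → D>0 d))) ⟩
        v c + (val q E + val q E) ∎
        where
        open ≤-Reasoning
        W : ℕ
        W = sumBelow (λ d → val q (D (suc d))) k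

    IsPrimeFactor : ℕ → Set
    IsPrimeFactor p = Prime p × p ∣ F

    isPrimeFactor? : Decidable IsPrimeFactor
    isPrimeFactor? p = prime? p ×-dec p ∣? F

    primeFactors : List ℕ
    primeFactors = filter isPrimeFactor? (downFrom (suc F))

    peakPower : ℕ → ℕ
    peakPower q = q ^ val q (term (peak q))

    Π : ℕ
    Π = product (map peakPower primeFactors)

    Π>0 : 0 < Π
    Π>0 = product-map>0 peakPower primeFactors (All.map peakPower>0
      (All.all-filter isPrimeFactor? (downFrom (suc F))))
      where
      peakPower>0 : ∀ {q} → IsPrimeFactor q → 0 < peakPower q
      peakPower>0 {q} (q-prime , _) = m^n>0 q {{prime⇒nonZero q-prime}} (val q (term (peak q)))

    Π-upper : Π ≤ blockBound k′ ^ length primeFactors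
    Π-upper = product-map-upper peakPower (blockBound k′) primeFactors (All.map peakPower≤
      (All.all-filter isPrimeFactor? (downFrom (suc F))))
      where
      peakPower≤ : ∀ {q} → IsPrimeFactor q → peakPower q ≤ blockBound k′
      peakPower≤ (q-prime , _) = ≤-trans (∣⇒≤ {{>-nonZero (term>0 c)}} (qᵛ∣term c)) (term-upper c c<k)
        where open PeakBound _ q-prime

    val-F≤ : ∀ q → Prime q → val q F ≤ val q (Π * (E * E))
    val-F≤ q q-prime with q ∣? F
    ... | no  q∤F = subst (_≤ val q (Π * (E * E))) (sym (∤⇒val≡0 q-prime F>0 q∤F)) z≤n
    ... | yes q∣F = begin
      val q F                        ≤⟨ val-F-bound ⟩
      v c + (val q E + val q E)      ≤⟨ +-monoˡ-≤ _ v-peak≤val-Π ⟩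
      val q Π + (val q E + val q E)  ≡⟨ cong (val q Π +_) (sym (val-* q-prime E>0 E>0)) ⟩
      val q Π + val q (E * E)        ≡⟨ sym (val-* q-prime Π>0 (*-mono-≤ E>0 E>0)) ⟩
      val q (Π * (E * E))            ∎
      where
      open ≤-Reasoning
      open PeakBound q q-prime
      q∈primeFactors : q ∈ primeFactors
      q∈primeFactors = ∈-filter⁺ isPrimeFactor? (∈-downFrom⁺ (s≤s (∣⇒≤ {{>-nonZero F>0}} q∣F))) (q-prime , q∣F)
      v-peak≤val-Π : v c ≤ val q Π
      v-peak≤val-Π = val-maximal q-prime Π>0 (∈⇒∣product (∈-map⁺ peakPower q∈primeFactors))

    F∣ΠE² : F ∣ Π * (E * E)
    F∣ΠE² = ∣-byValuations F>0 (*-mono-≤ Π>0 (*-mono-≤ E>0 E>0)) val-F≤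

    s : ℕ
    s = length primeFactors

    -- Sizes in F ∣ Π·E², measured in powers of A:
    -- A^((3k+2)k) ≤ F and Π·E² ≤ A^((4k+3)s + 2(k+1)k).
    exponent-comparison : (3 * k + 2) * k ≤ (4 * k + 3) * s + (suc k * k + suc k * k)
    exponent-comparison = ^-cancelʳ-≤ A A>1 (begin
      A ^ ((3 * k + 2) * k)               ≡⟨ sym (^-*-assoc A (3 * k + 2) k) ⟩
      (A ^ (3 * k + 2)) ^ k               ≤⟨ prodBelow-lower term k _ (λ i _ → term-lower i) ⟩
      F                                   ≤⟨ ∣⇒≤ {{>-nonZero (*-mono-≤ Π>0 (*-mono-≤ E>0 E>0))}} F∣ΠE² ⟩
      Π * (E * E)                         ≤⟨ *-mono-≤ Π-upper (*-mono-≤ E-upper E-upper) ⟩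
      (A ^ (4 * k + 3)) ^ s * ((A ^ suc k) ^ k * (A ^ suc k) ^ k)
        ≡⟨ cong₂ _*_ (^-*-assoc A (4 * k + 3) s) (cong₂ _*_ (^-*-assoc A (suc k) k) (^-*-assoc A (suc k) k)) ⟩
      A ^ ((4 * k + 3) * s) * (A ^ (suc k * k) * A ^ (suc k * k))
        ≡⟨ cong (A ^ ((4 * k + 3) * s) *_) (sym (^-distribˡ-+-* A (suc k * k) (suc k * k))) ⟩
      A ^ ((4 * k + 3) * s) * A ^ (suc k * k + suc k * k)
        ≡⟨ sym (^-distribˡ-+-* A ((4 * k + 3) * s) (suc k * k + suc k * k)) ⟩
      A ^ ((4 * k + 3) * s + (suc k * k + suc k * k)) ∎)
      where
      open ≤-Reasoning
      E-upper : E ≤ (A ^ suc k) ^ k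
      E-upper = prodBelow-upper (λ d → D (suc d)) k (A ^ suc k)
        (λ d d<k → ≤-trans (D-upper (suc d)) (^-monoʳ-≤ A (s≤s d<k)))

    k≤7s : k ≤ 7 * s
    k≤7s = *-cancelˡ-≤ k (begin
      k * k                ≤⟨ +-cancelʳ-≤ (suc k * k + suc k * k) (k * k) ((4 * k + 3) * s)
                                (subst (_≤ (4 * k + 3) * s + (suc k * k + suc k * k)) (split k) exponent-comparison) ⟩
      (4 * k + 3) * s      ≤⟨ *-monoˡ-≤ s (+-monoʳ-≤ (4 * k) (*-monoʳ-≤ 3 (s≤s z≤n))) ⟩
      (4 * k + 3 * k) * s  ≡⟨ regroup k s ⟩
      k * (7 * s)          ∎)
      where
      open ≤-Reasoning
      split : ∀ k → (3 * k + 2) * k ≡ k * k + (suc k * k + suc k * k)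
      split = solve-∀
      regroup : ∀ k s → (4 * k + 3 * k) * s ≡ k * (7 * s)
      regroup = solve-∀

    IsGoodFactor : ℕ → Set
    IsGoodFactor p = Prime p × p ∣ F × ¬ (p ∣ B)

    isGoodFactor? : Decidable IsGoodFactor
    isGoodFactor? p = prime? p ×-dec p ∣? F ×-dec ¬? (p ∣? B)

    goodPrimes : List ℕ
    goodPrimes = filter isGoodFactor? (downFrom (suc F))

    s≤goodPrimes+B+1 : s ≤ length goodPrimes + suc B
    s≤goodPrimes+B+1 = ≤-trans
      (length-filter-cover isPrimeFactor? isGoodFactor? divides-b? good-or-divides-b (downFrom (suc F)))
      (+-monoʳ-≤ (length goodPrimes)
        (length-filter-downFrom-bounded divides-b? B (λ p∣B → ∣⇒≤ {{>-nonZero B>0}} p∣B) (suc F)))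
      where
      divides-b? : Decidable (_∣ B)
      divides-b? p = p ∣? B
      good-or-divides-b : ∀ {p} → IsPrimeFactor p → IsGoodFactor p ⊎ p ∣ B
      good-or-divides-b {p} (p-prime , p∣F) with p ∣? B
      ... | yes p∣B = inj₂ p∣B
      ... | no  p∤B = inj₁ (p-prime , p∣F , p∤B)

    -- Each good factor p of the block is a good prime for every x ≥ blockBound:
    -- p divides some term N (T + i) = ∣b − a^(2B(T+i))∣, hence p ≤ x, and
    -- p ∤ a because otherwise p would divide b.
    goodFactor-isGood : ∀ x → blockBound k′ ≤ x → ∀ {p} → IsGoodFactor p → Good a b x p
    goodFactor-isGood x x≥bound {p} (p-prime , p∣F , p∤B) with prime∣prodBelow term k p-prime p∣F
    ... | i , i<k , p∣termᵢ = p-prime , p≤x , p∤ab , (2 * B * (T + i) , subst (p ∣_) (N≡∣b-aⁿ∣ (T + i)) p∣termᵢ)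
      where
      p≤x : p ≤ x
      p≤x = ≤-trans (∣⇒≤ {{>-nonZero (term>0 i)}} p∣termᵢ) (≤-trans (term-upper i i<k) x≥bound)
      p∤ab : ¬ (p ∣ ∣ a ℤ.* b ∣)
      p∤ab p∣ab with euclidsLemma ∣ a ∣ B p-prime (subst (p ∣_) (ℤP.∣i*j∣≡∣i∣*∣j∣ a b) p∣ab)
      ... | inj₁ p∣a = p∤B (N-divisor-of-a p (3 * k + 2 + i) p∣a p∣termᵢ)
      ... | inj₂ p∣B = p∤B p∣B

    goodPrimes-unique : Unique goodPrimes
    goodPrimes-unique = Unique.filter⁺ isGoodFactor? (Unique.downFrom⁺ (suc F))

    goodPrimes-good : ∀ x → blockBound k′ ≤ x → All (Good a b x) goodPrimes
    goodPrimes-good x x≥bound = All.map (goodFactor-isGood x x≥bound) (All.all-filter isGoodFactor? (downFrom (suc F)))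

    goodPrimes-many : k ≤ 7 * (length goodPrimes + suc B)
    goodPrimes-many = ≤-trans k≤7s (*-monoʳ-≤ 7 s≤goodPrimes+B+1)

  blockBound-< : ∀ k′ → blockBound k′ < blockBound (suc k′)
  blockBound-< k′ = ^-monoʳ-< A A>1 (+-monoˡ-< 3 (*-monoʳ-< 4 (n<1+n (suc k′))))

  nextBound≤2^[c*goodPrimes] : ∀ k′ → 14 * suc B ≤ suc k′ →
    blockBound (suc k′) ≤ 2 ^ (suc (154 * A) * length (Block.goodPrimes k′))
  nextBound≤2^[c*goodPrimes] k′ long = begin
    A ^ (4 * suc (suc k′) + 3)  ≤⟨ ^-monoʳ-≤ A (block-exponent-bound k′ g (suc B) long (Block.goodPrimes-many k′)) ⟩
    A ^ (154 * g)               ≤⟨ ^-monoˡ-≤ (154 * g) (<⇒≤ (n<m^n 2 A (s≤s (s≤s z≤n)))) ⟩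
    (2 ^ A) ^ (154 * g)         ≡⟨ ^-*-assoc 2 A (154 * g) ⟩
    2 ^ (A * (154 * g))         ≡⟨ cong (2 ^_) (regroup A g) ⟩
    2 ^ (154 * A * g)           ≤⟨ ^-monoʳ-≤ 2 (*-monoˡ-≤ g (n≤1+n (154 * A))) ⟩
    2 ^ (suc (154 * A) * g)     ∎
    where
    open ≤-Reasoning
    g : ℕ
    g = length (Block.goodPrimes k′)
    regroup : ∀ A g → A * (154 * g) ≡ 154 * A * g
    regroup = solve-∀

-- Cover [blockBound k₀, ∞) by the intervals between
-- consecutive block bounds; for x in the interval starting at block k ≥ k₀,
-- the good primes of block k are good for x and already force
-- x < blockBound (k + 1) ≤ 2^((154A + 1)·#goodPrimes).
theorem1p1 : (a b : ℤ) → a ≢ 0ℤ → b ≢ 0ℤ → ∣ a ∣ ≢ 1 →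
    ∃[ k ] ∃[ x₀ ] ((x : ℕ) → x₀ ≤ x →
      ∃[ ps ] (Unique ps × All (Good a b x) ps × x ≤ 2 ^ (suc k * length ps)))
theorem1p1 a b a≢0 b≢0 ∣a∣≢1 = 154 * A , blockBound k₀ , goodPrimesUpTo
  where
  open Sequence a b a≢0 b≢0 ∣a∣≢1
  k₀ : ℕ
  k₀ = 14 * suc B
  goodPrimesUpTo : (x : ℕ) → blockBound k₀ ≤ x →
    ∃[ ps ] (Unique ps × All (Good a b x) ps × x ≤ 2 ^ (suc (154 * A) * length ps))
  goodPrimesUpTo x x₀≤x with bracket (λ j → blockBound (j + k₀)) (λ j → blockBound-< (j + k₀)) x x₀≤x
  ... | j , bound≤x , x<next = goodPrimes , goodPrimes-unique , goodPrimes-good x bound≤x ,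
        ≤-trans (<⇒≤ x<next) (nextBound≤2^[c*goodPrimes] (j + k₀) (≤-trans (m≤n+m k₀ j) (n≤1+n _)))
    where open Block (j + k₀)
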